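{- Let $t,u$ be checkers terms, $c,b\in\{\circ,\bullet\}$, and suppose $\Gamma\vdash^kt:M\to_cL$ and $\Delta\vdash^lu:N$ are derivable, where either $M\le^-_dN$ or $N\le^+_dM$. Then there exist environments $\Gamma',\Delta'$, a linear type $L'$, an integer $m$ and $d'$ with $0\le d'\le d$ such that $\Gamma'+\Delta'\vdash^mt\cdot^bu:L'$ is derivable, $(\Gamma'+\Delta',L')\le^+_{d'}(\Gamma+\Delta,L)$, and $m\le k+l+\delta(c,b)+d-d'$, where $\delta(c,b)=1$ if $c\ne b$ and $\delta(c,b)=0$ if $c=b$.
   Context: Checkers terms: $t ::= x\mid\lambda_cx.t\mid t\cdot^cu$, $c\in\{\circ,\bullet\}$. Types: linear $L ::= X\mid M\to_cL$; multi $M ::= [L_1,\ldots,L_n]$ (finite multisets); environments $\Gamma$ (finite support), pointwise $+$, $\Gamma,x:M$ with $x\notin\mathrm{supp}(\Gamma)$. Rules: (ax) $x:[L]\vdash^0x:L$; (many) from $\Gamma_i\vdash^{k_i}t:L_i$ ($i\in I$ finite) infer $\sum\Gamma_i\vdash^{\sum k_i}t:[L_i]_{i\in I}$; ($\lambda$) from $\Gamma,x:M\vdash^kt:L$ infer $\Gamma\vdash^k\lambda_cx.t:M\to_cL$; (@) from $\Gamma\vdash^{k_1}t:M\to_cL$ and $\Delta\vdash^{k_2}u:M$ infer $\Gamma+\Delta\vdash^kt\cdot^du:L$, $k=k_1+k_2$ if $c=d$, else $k_1+k_2+1$. Polarized whitening $\le^a_k$ ($a\in\{+,-\}$, $\bar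 a$ opposite), defined on linear and multi types by mutual induction: $X\le^a_0X$; if $M'\le^-_{k_1}M$, $L'\le^+_{k_2}L$ then $(M'\to_\circ L')\le^+_{k_1+k_2+1}(M\to_\bullet L)$; for any $c$, if $M'\le^{\bar a}_{k_1}M$, $L'\le^a_{k_2}L$ then $(M'\to_cL')\le^a_{k_1+k_2}(M\to_cL)$; $[L'_1,\ldots,L'_n]\le^a_{\sum k_i}[L_1,\ldots,L_n]$ when $L'_i\le^a_{k_i}L_i$; no other rules. Environments: $\Gamma'\le^a_k\Gamma$ iff $\Gamma'(x)\le^a_{k_x}\Gamma(x)$ for all $x$ with $\sum_xk_x=k$. Pairs: $(\Gamma',L')\le^a_{k_1+k_2}(\Gamma,L)$ iff $\Gamma'\le^{\bar a}_{k_1}\Gamma$ and $L'\le^a_{k_2}L$. -}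

module Defs where

open import Data.Nat using (ℕ; zero; suc; _+_; _≤_; _≡ᵇ_)
open import Data.Bool using (if_then_else_)
open import Data.List using (List; []; _∷_; _++_; map; upTo)
open import Data.Nat.ListAction using (sum)
open import Data.Product using (Σ; _×_; _,_)
open import Relation.Binary.PropositionalEquality using (_≡_; _≢_)

data Col : Set where
  white : Col   -- ∘
  black : Col   -- •

δ : Col → Col → ℕ
δ white white = 0
δ black black = 0
δ white black = 1
δ black white = 1

data Term : Set where
  var : ℕ → Term
  lam : Col → ℕ → Term → Term
  app : Col → Term → Term → Term

-- Types.  Linear: L ::= X | M →_c L ; multi types M are finite multisets,
-- represented by lists and compared up to (nested) permutation.

data Lin : Set where
  tvar  : ℕ → Lin
  arrow : List Lin → Col → Lin → Lin

Multi : Set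
Multi = List Lin

data _≈L_ : Lin → Lin → Set
data _≈M_ : Multi → Multi → Set

data _≈L_ where
  ≈tvar  : ∀ {X} → tvar X ≈L tvar X
  ≈arrow : ∀ {M M' L L' c} → M ≈M M' → L ≈L L' → arrow M c L ≈L arrow M' c L'

data _≈M_ where
  ≈nil  : [] ≈M []
  ≈cons : ∀ {L L' Ms Ns Ns₁ Ns₂} → Ns ≡ Ns₁ ++ (L' ∷ Ns₂) →
          L ≈L L' → Ms ≈M (Ns₁ ++ Ns₂) → (L ∷ Ms) ≈M Ns

data Pol : Set where
  pos neg : Pol

opp : Pol → Pol
opp pos = neg
opp neg = pos

-- WL a k L' L  means  L' ≤^a_k L ;  WM a k M' M  means  M' ≤^a_k M
data WL : Pol → ℕ → Lin → Lin → Set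
data WM : Pol → ℕ → Multi → Multi → Set

data WL where
  w-var   : ∀ {a X} → WL a 0 (tvar X) (tvar X)
  w-black : ∀ {k₁ k₂ M' M L' L} → WM neg k₁ M' M → WL pos k₂ L' L →
            WL pos (k₁ + k₂ + 1) (arrow M' white L') (arrow M black L)
  w-arrow : ∀ {a c k₁ k₂ M' M L' L} → WM (opp a) k₁ M' M → WL a k₂ L' L →
            WL a (k₁ + k₂) (arrow M' c L') (arrow M c L)

-- [L'_1..L'_n] ≤^a_{Σ k_i} [L_1..L_n] with L'_i ≤^a_{k_i} L_i
-- (lists taken up to permutation: the matching is an arbitrary bijection)
data WM where
  w-nil  : ∀ {a} → WM a 0 [] []
  w-cons : ∀ {a k₁ k₂ L' L Ms' Ns Ns₁ Ns₂} → Ns ≡ Ns₁ ++ (L ∷ Ns₂) →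
           WL a k₁ L' L → WM a k₂ Ms' (Ns₁ ++ Ns₂) →
           WM a (k₁ + k₂) (L' ∷ Ms') Ns

-- Environments: maps from variables to multi types
-- (finite support is automatic for all environments appearing in derivations)

Env : Set
Env = ℕ → Multi

_+ᴱ_ : Env → Env → Env
(Γ +ᴱ Δ) x = Γ x ++ Δ x

emptyᴱ : Env
emptyᴱ _ = []

single : ℕ → Lin → Env
single x L y = if y ≡ᵇ x then (L ∷ []) else []

_≗ᴱ_ : Env → Env → Set
Γ ≗ᴱ Δ = ∀ x → Γ x ≡ Δ x

-- Γ' ≤^a_k Γ  iff  Γ'(x) ≤^a_{k_x} Γ(x) for all x, with Σ_x k_x = k
-- (the family k_x has finite support, below the bound n)
WEnv : Pol → ℕ → Env → Env → Set
WEnv a k Γ' Γ =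
  Σ (ℕ → ℕ) λ f →
    (∀ x → WM a (f x) (Γ' x) (Γ x)) ×
    Σ ℕ λ n → (∀ x → n ≤ x → f x ≡ 0) × sum (map f (upTo n)) ≡ k

WPair : Pol → ℕ → Env × Lin → Env × Lin → Set
WPair a k (Γ' , L') (Γ , L) =
  Σ ℕ λ k₁ → Σ ℕ λ k₂ → k ≡ k₁ + k₂ × WEnv (opp a) k₁ Γ' Γ × WL a k₂ L' L

data _⊢[_]_∶_ : Env → ℕ → Term → Lin → Set
data _⊢m[_]_∶_ : Env → ℕ → Term → Multi → Set

data _⊢[_]_∶_ where
  ax  : ∀ {Γ x L} → Γ ≗ᴱ single x L → Γ ⊢[ 0 ] var x ∶ L
  -- Γ , x : M ⊢ t : L  gives  Γ ⊢ λ_c x.t : M →_c L   (Θ = Γ , x : Θ x)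
  lm  : ∀ {Γ Θ k t L} c x → Θ ⊢[ k ] t ∶ L →
        Γ x ≡ [] → (∀ y → y ≢ x → Γ y ≡ Θ y) →
        Γ ⊢[ k ] lam c x t ∶ arrow (Θ x) c L
  ap  : ∀ {Γ Δ Θ k₁ k₂ t u M M' L} c d →
        Γ ⊢[ k₁ ] t ∶ arrow M c L → Δ ⊢m[ k₂ ] u ∶ M' → M' ≈M M →
        Θ ≗ᴱ (Γ +ᴱ Δ) →
        Θ ⊢[ k₁ + k₂ + δ c d ] app d t u ∶ L

data _⊢m[_]_∶_ where
  many-nil  : ∀ {Γ t} → Γ ≗ᴱ emptyᴱ → Γ ⊢m[ 0 ] t ∶ []
  many-cons : ∀ {Γ₁ Γ₂ Θ k₁ k₂ t L M} →
              Γ₁ ⊢[ k₁ ] t ∶ L → Γ₂ ⊢m[ k₂ ] t ∶ M → Θ ≗ᴱ (Γ₁ +ᴱ Γ₂) →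
              Θ ⊢m[ k₁ + k₂ ] t ∶ (L ∷ M)

{-# OPTIONS --safe #-}
module Submission where

-- Every term t has a retyping property, proved by induction on t: if Γ ⊢ᵏ t : T and
-- (Γ₁, T₁) ≤⁻ (Γ, T) with weight w, then t has a typing Γ′ ⊢ᵏ′ t : T′ with
-- (Γ′, T′) ≤⁺ (Γ₁, T₁) with weight w′, where k′ + w′ ≤ k + w and w′ ≤ w.  For a
-- variable, the two whitenings of opposite polarity of its type are completed to a
-- commuting square; for an abstraction, the whitened domain is moved into the
-- environment.  For an application s ·ᵈ v, the domain D of s and the type V of v are
-- made to agree by alternation: retyping v against D gives a type V′ ≤⁺ D, and
-- retyping s against the arrow with domain V′ gives a new domain D′ ≤⁻ V′.  A
-- whitening of weight m removes exactly m black arrows, so as long as V′ ≤⁺ D has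
-- nonzero weight the number of black arrows in D strictly decreases, and the
-- alternation stops with matching types.  Proposition 3 is one such alternation,
-- started from the given mismatch d.

open import Defs
open import Data.Nat using (ℕ; _+_; _≤_)
open import Data.Product using (Σ; _×_; _,_)
open import Data.Sum using (_⊎_)

open import Data.Bool using (if_then_else_)
open import Data.Empty using (⊥-elim)
open import Data.List using (List; []; _∷_; _++_; map; upTo)
open import Data.List.Properties using (map-++; upTo-∷ʳ)
open import Data.Nat using (zero; suc; _<_; z≤n; s≤s; z<s; _≟_)
open import Data.Nat.ListAction using (sum)
open import Data.Nat.ListAction.Properties using (sum-++)
open import Data.Nat.Properties
open import Data.Nat.Tactic.RingSolver using (solve-∀)
open import Data.Product using (∃; ∃₂; proj₁; proj₂)
open import Data.Sum using (inj₁; inj₂)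
open import Function using (_∘_; _∘₂_)
open import Relation.Binary.PropositionalEquality
open import Relation.Nullary using (yes; no)
open import Relation.Nullary.Decidable using (dec-true; dec-false)

open import Algebra.Properties.CommutativeSemigroup +-commutativeSemigroup
  using (interchange; x∙yz≈y∙xz; xy∙z≈xz∙y)

private variable
  A : Set
  α β : A
  xs ys zs : List A
  x : ℕ
  t u : Term
  a b : Pol
  c d : Col
  N K W j k k₁ k₂ : ℕ
  L L′ L″ T₁ : Lin
  M M′ M″ Ms Ns Ns′ : Multi
  Γ Γ′ Γ″ Δ Δ′ Θ Θ′ : Env

data Insert {A : Set} (α : A) : List A → List A → Set where
  here  : Insert α xs (α ∷ xs)
  there : Insert α xs ys → Insert α (β ∷ xs) (β ∷ ys)

Insert⇒++ : Insert α xs ys → ∃₂ λ P Q → ys ≡ P ++ α ∷ Q × xs ≡ P ++ Q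
Insert⇒++ here = [] , _ , refl , refl
Insert⇒++ (there {β = β} i) with Insert⇒++ i
... | P , Q , refl , refl = β ∷ P , Q , refl , refl

++⇒Insert : ∀ P Q → Insert α (P ++ Q) (P ++ α ∷ Q)
++⇒Insert []      Q = here
++⇒Insert (p ∷ P) Q = there (++⇒Insert P Q)

Insert-diamond : Insert α xs zs → Insert β ys zs →
                 (α ≡ β × xs ≡ ys) ⊎ ∃ λ ws → Insert β ws xs × Insert α ws ys
Insert-diamond here      here      = inj₁ (refl , refl)
Insert-diamond here      (there j) = inj₂ (_ , j , here)
Insert-diamond (there i) here      = inj₂ (_ , here , i)
Insert-diamond (there i) (there j) with Insert-diamond i j
... | inj₁ (refl , refl)  = inj₁ (refl , refl)
... | inj₂ (ws , i′ , j′) = inj₂ (_ ∷ ws , there i′ , there j′)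

Insert-exchange : Insert α ys zs → Insert β xs ys →
                  ∃ λ ws → Insert β ws zs × Insert α xs ws
Insert-exchange here      j         = _ , there j , here
Insert-exchange (there i) here      = _ , here , i
Insert-exchange (there i) (there j) with Insert-exchange i j
... | ws , i′ , j′ = _ ∷ ws , there i′ , there j′

-- WL and WM, with the matching of a multiset given by an insertion instead of a
-- splitting of the list; this form is easier to invert.
data WhL : Pol → ℕ → Lin → Lin → Set
data WhM : Pol → ℕ → Multi → Multi → Set

data WhL where
  w-var   : ∀ {a X} → WhL a 0 (tvar X) (tvar X)
  w-black : ∀ {k₁ k₂ M′ M L′ L} → WhM neg k₁ M′ M → WhL pos k₂ L′ L →
            WhL pos (k₁ + k₂ + 1) (arrow M′ white L′) (arrow M black L)
  w-arrow : ∀ {a c k₁ k₂ M′ M L′ L} → WhM (opp a) k₁ M′ M → WhL a k₂ L′ L →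
            WhL a (k₁ + k₂) (arrow M′ c L′) (arrow M c L)

data WhM where
  w-nil  : ∀ {a} → WhM a 0 [] []
  w-cons : ∀ {a k₁ k₂ L′ L M′ Ns Ns′} → Insert L Ns Ns′ → WhL a k₁ L′ L → WhM a k₂ M′ Ns →
           WhM a (k₁ + k₂) (L′ ∷ M′) Ns′

WhL⇒WL : WhL a k L′ L → WL a k L′ L
WhM⇒WM : WhM a k M′ M → WM a k M′ M
WhL⇒WL w-var         = w-var
WhL⇒WL (w-black m l) = w-black (WhM⇒WM m) (WhL⇒WL l)
WhL⇒WL (w-arrow m l) = w-arrow (WhM⇒WM m) (WhL⇒WL l)
WhM⇒WM w-nil = w-nil
WhM⇒WM (w-cons i l m) with Insert⇒++ i
... | _ , _ , M≡ , refl = w-cons M≡ (WhL⇒WL l) (WhM⇒WM m)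

WL⇒WhL : WL a k L′ L → WhL a k L′ L
WM⇒WhM : WM a k M′ M → WhM a k M′ M
WL⇒WhL w-var         = w-var
WL⇒WhL (w-black m l) = w-black (WM⇒WhM m) (WL⇒WhL l)
WL⇒WhL (w-arrow m l) = w-arrow (WM⇒WhM m) (WL⇒WhL l)
WM⇒WhM w-nil = w-nil
WM⇒WhM (w-cons {Ns₁ = P} {Ns₂ = Q} refl l m) = w-cons (++⇒Insert P Q) (WL⇒WhL l) (WM⇒WhM m)

≈L⇒WhL : L′ ≈L L → WhL a 0 L′ L
≈M⇒WhM : M′ ≈M M → WhM a 0 M′ M
≈L⇒WhL ≈tvar         = w-var
≈L⇒WhL (≈arrow m l) = w-arrow (≈M⇒WhM m) (≈L⇒WhL l)
≈M⇒WhM ≈nil = w-nil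
≈M⇒WhM (≈cons {Ns₁ = P} {Ns₂ = Q} refl l m) = w-cons (++⇒Insert P Q) (≈L⇒WhL l) (≈M⇒WhM m)

WhL-zero⇒≈L : WhL a k L′ L → k ≡ 0 → L′ ≈L L
WhM-zero⇒≈M : WhM a k M′ M → k ≡ 0 → M′ ≈M M
WhL-zero⇒≈L w-var _ = ≈tvar
WhL-zero⇒≈L (w-black {k₁ = k₁} {k₂ = k₂} _ _) k≡0 with () ← m+n≡0⇒n≡0 (k₁ + k₂) k≡0
WhL-zero⇒≈L (w-arrow {k₁ = k₁} m l) k≡0 =
  ≈arrow (WhM-zero⇒≈M m (m+n≡0⇒m≡0 k₁ k≡0)) (WhL-zero⇒≈L l (m+n≡0⇒n≡0 k₁ k≡0))
WhM-zero⇒≈M w-nil _ = ≈nil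
WhM-zero⇒≈M (w-cons {k₁ = k₁} i l m) k≡0 with Insert⇒++ i
... | _ , _ , M≡ , refl =
  ≈cons M≡ (WhL-zero⇒≈L l (m+n≡0⇒m≡0 k₁ k≡0)) (WhM-zero⇒≈M m (m+n≡0⇒n≡0 k₁ k≡0))

WhL-refl : ∀ L → WhL a 0 L L
WhM-refl : ∀ M → WhM a 0 M M
WhL-refl (tvar _)      = w-var
WhL-refl (arrow M c L) = w-arrow (WhM-refl M) (WhL-refl L)
WhM-refl []      = w-nil
WhM-refl (L ∷ M) = w-cons here (WhL-refl L) (WhM-refl M)

WhL-cast : k₁ ≡ k₂ → WhL a k₁ L′ L → WhL a k₂ L′ L
WhL-cast refl l = l

WhM-cast : k₁ ≡ k₂ → WhM a k₁ M′ M → WhM a k₂ M′ M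
WhM-cast refl m = m

WhM-insertˡ : Insert L′ M′ M″ → WhM a k M″ M → WhM a k (L′ ∷ M′) M
WhM-insertˡ here m = m
WhM-insertˡ (there i) (w-cons {k₁ = k₁} j l m) with WhM-insertˡ i m
... | w-cons {k₁ = j₁} {k₂ = j₂} j′ l′ m′ with Insert-exchange j j′
...   | _ , j″ , j‴ = WhM-cast (x∙yz≈y∙xz j₁ k₁ j₂) (w-cons j″ l′ (w-cons j‴ l m′))

WhM-removeʳ : WhM a k M′ M → Insert L M″ M →
              ∃₂ λ L′ M‴ → Insert L′ M‴ M′ × ∃₂ λ j₁ j₂ →
                WhL a j₁ L′ L × WhM a j₂ M‴ M″ × k ≡ j₁ + j₂
WhM-removeʳ (w-cons {k₁ = k₁} i l m) j with Insert-diamond i j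
... | inj₁ (refl , refl) = _ , _ , here , _ , _ , l , m , refl
... | inj₂ (_ , i′ , j′) with WhM-removeʳ m i′
...   | _ , _ , i″ , j₁ , j₂ , l′ , m′ , refl =
  _ , _ , there i″ , j₁ , k₁ + j₂ , l′ , w-cons j′ l m′ , x∙yz≈y∙xz k₁ j₁ j₂

WhL-trans : WhL a k₁ L″ L′ → WhL a k₂ L′ L → WhL a (k₁ + k₂) L″ L
WhM-trans : WhM a k₁ M″ M′ → WhM a k₂ M′ M → WhM a (k₁ + k₂) M″ M
WhL-trans w-var w-var = w-var
WhL-trans (w-black {k₁ = a₁} {k₂ = a₂} m l) (w-arrow {k₁ = b₁} {k₂ = b₂} m′ l′) =
  WhL-cast (shuffle a₁ a₂ b₁ b₂) (w-black (WhM-trans m m′) (WhL-trans l l′))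
  where shuffle : ∀ a₁ a₂ b₁ b₂ → a₁ + b₁ + (a₂ + b₂) + 1 ≡ a₁ + a₂ + 1 + (b₁ + b₂)
        shuffle = solve-∀
WhL-trans (w-arrow {k₁ = a₁} {k₂ = a₂} m l) (w-black {k₁ = b₁} {k₂ = b₂} m′ l′) =
  WhL-cast (shuffle a₁ a₂ b₁ b₂) (w-black (WhM-trans m m′) (WhL-trans l l′))
  where shuffle : ∀ a₁ a₂ b₁ b₂ → a₁ + b₁ + (a₂ + b₂) + 1 ≡ a₁ + a₂ + (b₁ + b₂ + 1)
        shuffle = solve-∀
WhL-trans (w-arrow {k₁ = a₁} {k₂ = a₂} m l) (w-arrow {k₁ = b₁} {k₂ = b₂} m′ l′) =
  WhL-cast (interchange a₁ b₁ a₂ b₂) (w-arrow (WhM-trans m m′) (WhL-trans l l′))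
WhM-trans w-nil w-nil = w-nil
WhM-trans (w-cons {k₁ = a₁} {k₂ = a₂} i l m) m₂ with WhM-insertˡ i m₂
... | w-cons {k₁ = b₁} {k₂ = b₂} j l′ m′ =
  WhM-cast (interchange a₁ b₁ a₂ b₂) (w-cons j (WhL-trans l l′) (WhM-trans m m′))

WhL-square : WhL a k₁ L′ L → WhL (opp a) k₂ L″ L →
             ∃ λ L‴ → WhL (opp a) k₂ L‴ L′ × WhL a k₁ L‴ L″
WhM-square : WhM a k₁ M′ M → WhM (opp a) k₂ M″ M →
             ∃ λ M‴ → WhM (opp a) k₂ M‴ M′ × WhM a k₁ M‴ M″
WhL-square w-var w-var = _ , w-var , w-var
WhL-square (w-black m l) (w-arrow m′ l′)
  with _ , p₁ , p₂ ← WhM-square m m′ | _ , q₁ , q₂ ← WhL-square l l′ =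
  _ , w-arrow p₁ q₁ , w-black p₂ q₂
WhL-square {a = pos} (w-arrow m l) (w-arrow m′ l′)
  with _ , p₁ , p₂ ← WhM-square m m′ | _ , q₁ , q₂ ← WhL-square l l′ =
  _ , w-arrow p₁ q₁ , w-arrow p₂ q₂
WhL-square {a = neg} (w-arrow m l) (w-black m′ l′)
  with _ , p₁ , p₂ ← WhM-square m m′ | _ , q₁ , q₂ ← WhL-square l l′ =
  _ , w-black p₁ q₁ , w-arrow p₂ q₂
WhL-square {a = neg} (w-arrow m l) (w-arrow m′ l′)
  with _ , p₁ , p₂ ← WhM-square m m′ | _ , q₁ , q₂ ← WhL-square l l′ =
  _ , w-arrow p₁ q₁ , w-arrow p₂ q₂
WhM-square w-nil w-nil = _ , w-nil , w-nil
WhM-square (w-cons i l m) m₂ with WhM-removeʳ m₂ i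
... | _ , _ , j , _ , _ , l′ , m′ , refl
  with _ , p₁ , p₂ ← WhM-square m m′ | _ , q₁ , q₂ ← WhL-square l l′ =
  _ , w-cons here q₁ p₁ , w-cons j q₂ p₂

blackness : Col → ℕ
blackness black = 1
blackness white = 0

blacksL : Lin → ℕ
blacksM : Multi → ℕ
blacksL (tvar _)      = 0
blacksL (arrow M c L) = blacksM M + blackness c + blacksL L
blacksM []      = 0
blacksM (L ∷ M) = blacksL L + blacksM M

blacks-Insert : Insert L M′ M → blacksM M ≡ blacksL L + blacksM M′
blacks-Insert here = refl
blacks-Insert {L = L} {M′ = L′ ∷ M′} (there i)
  rewrite blacks-Insert i = x∙yz≈y∙xz (blacksL L′) (blacksL L) (blacksM M′)

blacks-WhL : WhL a k L′ L → blacksL L′ + k ≡ blacksL L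
blacks-WhM : WhM a k M′ M → blacksM M′ + k ≡ blacksM M
blacks-WhL w-var = refl
blacks-WhL (w-black {k₁ = k₁} {k₂ = k₂} {M′ = M′} {L′ = L′} m l)
  rewrite sym (blacks-WhM m) | sym (blacks-WhL l) = shuffle (blacksM M′) (blacksL L′) k₁ k₂
  where shuffle : ∀ a b c d → a + 0 + b + (c + d + 1) ≡ a + c + 1 + (b + d)
        shuffle = solve-∀
blacks-WhL (w-arrow {c = c} {k₁ = k₁} {k₂ = k₂} {M′ = M′} {L′ = L′} m l)
  rewrite sym (blacks-WhM m) | sym (blacks-WhL l) = shuffle (blacksM M′) (blacksL L′) k₁ k₂ (blackness c)
  where shuffle : ∀ a b c d e → a + e + b + (c + d) ≡ a + c + e + (b + d)
        shuffle = solve-∀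
blacks-WhM w-nil = refl
blacks-WhM (w-cons {k₁ = k₁} {k₂ = k₂} {L′ = L′} {M′ = M′} i l m)
  rewrite blacks-Insert i | sym (blacks-WhM m) | sym (blacks-WhL l) =
  interchange (blacksL L′) (blacksM M′) k₁ k₂

blacks-WhM-≤ : WhM a k M′ M → blacksM M′ ≤ blacksM M
blacks-WhM-≤ {k = k} {M′ = M′} M′≤M = subst (blacksM M′ ≤_) (blacks-WhM M′≤M) (m≤m+n (blacksM M′) k)

blacks-WhM-< : WhM a (suc k) M′ M → blacksM M′ < blacksM M
blacks-WhM-< {k = k} {M′ = M′} M′≤M =
  subst (blacksM M′ <_) (blacks-WhM M′≤M) (m<m+n (blacksM M′) {suc k} z<s)

data WhPw (a : Pol) : ℕ → Multi → Multi → Set where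
  []  : WhPw a 0 [] []
  _∷_ : ∀ {k₁ k₂ L′ L M′ M} → WhL a k₁ L′ L → WhPw a k₂ M′ M →
        WhPw a (k₁ + k₂) (L′ ∷ M′) (L ∷ M)

WhPw-cast : k₁ ≡ k₂ → WhPw a k₁ M′ M → WhPw a k₂ M′ M
WhPw-cast refl p = p

WhPw⇒WhM : WhPw a k M′ M → WhM a k M′ M
WhPw⇒WhM []      = w-nil
WhPw⇒WhM (l ∷ p) = w-cons here l (WhPw⇒WhM p)

WhPw-refl : ∀ M → WhPw a 0 M M
WhPw-refl []      = []
WhPw-refl (L ∷ M) = WhL-refl L ∷ WhPw-refl M

WhPw-trans : WhPw a k₁ M″ M′ → WhPw a k₂ M′ M → WhPw a (k₁ + k₂) M″ M
WhPw-trans [] [] = []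
WhPw-trans (_∷_ {k₁ = a₁} {k₂ = a₂} l p) (_∷_ {k₁ = b₁} {k₂ = b₂} l′ p′) =
  WhPw-cast (interchange a₁ b₁ a₂ b₂) (WhL-trans l l′ ∷ WhPw-trans p p′)

WhPw-++ : WhPw a k₁ M′ M → WhPw a k₂ Ns′ Ns → WhPw a (k₁ + k₂) (M′ ++ Ns′) (M ++ Ns)
WhPw-++ []                            q = q
WhPw-++ (_∷_ {k₁ = j₁} {k₂ = j₂} l p) q = WhPw-cast (sym (+-assoc j₁ j₂ _)) (l ∷ WhPw-++ p q)

record WhPwSplit (a : Pol) (k : ℕ) (Ms M Ns : Multi) : Set where
  constructor whPwSplit
  field
    {Ms₁ Ms₂} : Multi
    {j₁ j₂}   : ℕ
    Ms-split  : Ms ≡ Ms₁ ++ Ms₂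
    Ms₁≤M     : WhPw a j₁ Ms₁ M
    Ms₂≤Ns    : WhPw a j₂ Ms₂ Ns
    k-split   : k ≡ j₁ + j₂

WhPw-split : ∀ M → WhPw a k Ms (M ++ Ns) → WhPwSplit a k Ms M Ns
WhPw-split []      p = whPwSplit refl [] p refl
WhPw-split (_ ∷ M) (_∷_ {k₁ = j} l p) with WhPw-split M p
... | whPwSplit {j₁ = k₁} {j₂ = k₂} refl p₁ p₂ refl =
  whPwSplit refl (l ∷ p₁) p₂ (sym (+-assoc j k₁ k₂))

WhPw-[]ʳ : WhPw a k M′ [] → M′ ≡ [] × k ≡ 0
WhPw-[]ʳ [] = refl , refl

WhPw-[-]ʳ : WhPw a k M′ (L ∷ []) → ∃ λ L′ → M′ ≡ L′ ∷ [] × WhL a k L′ L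
WhPw-[-]ʳ (_∷_ {k₁ = k₁} l []) = _ , refl , WhL-cast (sym (+-identityʳ k₁)) l

WhPw-insert : WhPw a k₂ M′ M → Insert L M Ns → WhL a k₁ L′ L →
              ∃ λ Ns′ → WhPw a (k₁ + k₂) Ns′ Ns × Insert L′ M′ Ns′
WhPw-insert p here l = _ , l ∷ p , here
WhPw-insert {k₁ = k₁} (_∷_ {k₁ = j₁} {k₂ = j₂} l₀ p) (there i) l with WhPw-insert p i l
... | _ , q , i′ = _ , WhPw-cast (x∙yz≈y∙xz j₁ k₁ j₂) (l₀ ∷ q) , there i′

WhM-insert-refl : Insert L M′ M″ → WhM a k M′ M → WhM a k M″ (L ∷ M)
WhM-insert-refl {L = L} here m = w-cons here (WhL-refl L) m
WhM-insert-refl (there i) (w-cons j l m) = w-cons (there j) l (WhM-insert-refl i m)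

WhM⇒WhPw : WhM a k M′ M → ∃ λ M″ → WhPw a k M″ M × WhM b 0 M″ M′
WhM⇒WhPw w-nil = [] , [] , w-nil
WhM⇒WhPw (w-cons i l m) with WhM⇒WhPw m
... | _ , p , m′ with WhPw-insert p i l
...   | M″ , q , i′ = M″ , q , WhM-insert-refl i′ m′

sumBelow : ℕ → (ℕ → ℕ) → ℕ
sumBelow zero    f = 0
sumBelow (suc n) f = sumBelow n f + f n

sum-upTo : ∀ n f → sum (map f (upTo n)) ≡ sumBelow n f
sum-upTo zero    f = refl
sum-upTo (suc n) f = begin
  sum (map f (upTo (suc n)))        ≡⟨ cong (sum ∘ map f) (sym (upTo-∷ʳ n)) ⟩
  sum (map f (upTo n ++ n ∷ []))    ≡⟨ cong sum (map-++ f (upTo n) (n ∷ [])) ⟩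
  sum (map f (upTo n) ++ f n ∷ [])  ≡⟨ sum-++ (map f (upTo n)) (f n ∷ []) ⟩
  sum (map f (upTo n)) + (f n + 0)  ≡⟨ cong₂ _+_ (sum-upTo n f) (+-identityʳ (f n)) ⟩
  sumBelow n f + f n                ∎
  where open ≡-Reasoning

sumBelow-cong< : ∀ n {f g} → (∀ x → x < n → f x ≡ g x) → sumBelow n f ≡ sumBelow n g
sumBelow-cong< zero    f≡g = refl
sumBelow-cong< (suc n) f≡g =
  cong₂ _+_ (sumBelow-cong< n (λ x x<n → f≡g x (m≤n⇒m≤1+n x<n))) (f≡g n ≤-refl)

sumBelow-cong : ∀ n {f g} → (∀ x → f x ≡ g x) → sumBelow n f ≡ sumBelow n g
sumBelow-cong n f≡g = sumBelow-cong< n (λ x _ → f≡g x)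

sumBelow-+ : ∀ n f g → sumBelow n (λ x → f x + g x) ≡ sumBelow n f + sumBelow n g
sumBelow-+ zero    f g = refl
sumBelow-+ (suc n) f g rewrite sumBelow-+ n f g = interchange (sumBelow n f) (sumBelow n g) (f n) (g n)

sumBelow-0 : ∀ n → sumBelow n (λ _ → 0) ≡ 0
sumBelow-0 zero    = refl
sumBelow-0 (suc n) = cong (_+ 0) (sumBelow-0 n)

update : (ℕ → A) → ℕ → A → ℕ → A
update f x v y with y ≟ x
... | yes _ = v
... | no  _ = f y

update-here : ∀ (f : ℕ → A) x v → update f x v x ≡ v
update-here f x v with x ≟ x
... | yes _   = refl
... | no  x≢x = ⊥-elim (x≢x refl)

update-there : ∀ (f : ℕ → A) x v {y} → y ≢ x → update f x v y ≡ f y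
update-there f x v {y} y≢x with y ≟ x
... | yes y≡x = ⊥-elim (y≢x y≡x)
... | no  _   = refl

update-agree : ∀ {f g : ℕ → A} → (∀ y → y ≢ x → f y ≡ g y) → ∀ y → update f x (g x) y ≡ g y
update-agree {x = x} f≡g y with y ≟ x
... | yes refl = refl
... | no  y≢x  = f≡g y y≢x

sumBelow-update : ∀ n f x v → x < n → sumBelow n (update f x v) + f x ≡ sumBelow n f + v
sumBelow-update (suc n) f x v (s≤s x≤n) with m≤n⇒m<n∨m≡n x≤n
... | inj₂ refl rewrite sumBelow-cong< n (λ y y<n → update-there f x v (<⇒≢ y<n)) | update-here f x v =
  xy∙z≈xz∙y (sumBelow n f) v (f x)
... | inj₁ x<n rewrite update-there f x v (<⇒≢ x<n ∘ sym) = begin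
  sumBelow n (update f x v) + f n + f x  ≡⟨ xy∙z≈xz∙y (sumBelow n (update f x v)) (f n) (f x) ⟩
  sumBelow n (update f x v) + f x + f n  ≡⟨ cong (_+ f n) (sumBelow-update n f x v x<n) ⟩
  sumBelow n f + v + f n                 ≡⟨ xy∙z≈xz∙y (sumBelow n f) v (f n) ⟩
  sumBelow n f + f n + v                 ∎
  where open ≡-Reasoning

single-here : ∀ x L → single x L x ≡ L ∷ []
single-here x L = cong (λ b → if b then L ∷ [] else []) (dec-true (x ≟ x) refl)

single-there : ∀ x L {y} → y ≢ x → single x L y ≡ []
single-there x L {y} y≢x = cong (λ b → if b then L ∷ [] else []) (dec-false (y ≟ x) y≢x)

sumBelow-single : ∀ N {f} x → x < N → (∀ y → y ≢ x → f y ≡ 0) → sumBelow N f ≡ f x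
sumBelow-single N {f} x x<N f≡0 = begin
  sumBelow N f                                ≡⟨ sumBelow-cong N (update-agree (sym ∘₂ f≡0)) ⟨
  sumBelow N (update (λ _ → 0) x (f x))       ≡⟨ +-identityʳ _ ⟨
  sumBelow N (update (λ _ → 0) x (f x)) + 0   ≡⟨ sumBelow-update N (λ _ → 0) x (f x) x<N ⟩
  sumBelow N (λ _ → 0) + f x                  ≡⟨ cong (_+ f x) (sumBelow-0 N) ⟩
  f x                                         ∎
  where open ≡-Reasoning

-- WEnv with the multi types matched in list order (WhM⇒WhPw reorders), and with
-- the weights summed over the variables below a fixed bound N.
record WhEnv (a : Pol) (N k : ℕ) (Γ′ Γ : Env) : Set where
  constructor whEnv
  field
    weight    : ℕ → ℕ
    pointwise : ∀ x → WhPw a (weight x) (Γ′ x) (Γ x)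
    total     : sumBelow N weight ≡ k

WhEnv-refl : ∀ Γ → WhEnv a N 0 Γ Γ
WhEnv-refl {N = N} Γ = whEnv (λ _ → 0) (λ x → WhPw-refl (Γ x)) (sumBelow-0 N)

WhEnv-trans : WhEnv a N k₁ Γ″ Γ′ → WhEnv a N k₂ Γ′ Γ → WhEnv a N (k₁ + k₂) Γ″ Γ
WhEnv-trans {N = N} (whEnv w₁ p₁ refl) (whEnv w₂ p₂ refl) =
  whEnv (λ x → w₁ x + w₂ x) (λ x → WhPw-trans (p₁ x) (p₂ x)) (sumBelow-+ N w₁ w₂)

WhEnv-≗ˡ : Γ′ ≗ᴱ Γ″ → WhEnv a N k Γ′ Γ → WhEnv a N k Γ″ Γ
WhEnv-≗ˡ {a = a} Γ′≗Γ″ (whEnv w p total) =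
  whEnv w (λ x → subst (λ M′ → WhPw a (w x) M′ _) (Γ′≗Γ″ x) (p x)) total

WhEnv-≗ʳ : Γ ≗ᴱ Δ → WhEnv a N k Γ′ Γ → WhEnv a N k Γ′ Δ
WhEnv-≗ʳ {a = a} Γ≗Δ (whEnv w p total) = whEnv w (λ x → subst (WhPw a (w x) _) (Γ≗Δ x) (p x)) total

WhEnv-[]ʳ : (Γ′≤Γ : WhEnv a N k Γ′ Γ) → Γ x ≡ [] → Γ′ x ≡ [] × WhEnv.weight Γ′≤Γ x ≡ 0
WhEnv-[]ʳ {a = a} {x = x} (whEnv w p _) Γx≡[] = WhPw-[]ʳ (subst (WhPw a (w x) _) Γx≡[] (p x))

WhEnv-empty : Γ ≗ᴱ emptyᴱ → WhEnv a N 0 emptyᴱ Γ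
WhEnv-empty {a = a} {N = N} Γ≗∅ =
  whEnv (λ _ → 0) (λ x → subst (WhPw a 0 []) (sym (Γ≗∅ x)) []) (sumBelow-0 N)

WhEnv-+ : WhEnv a N k₁ Γ′ Γ → WhEnv a N k₂ Δ′ Δ → Θ ≗ᴱ (Γ +ᴱ Δ) →
          WhEnv a N (k₁ + k₂) (Γ′ +ᴱ Δ′) Θ
WhEnv-+ {a = a} {N = N} (whEnv w₁ p₁ refl) (whEnv w₂ p₂ refl) Θ≗Γ+Δ =
  whEnv (λ x → w₁ x + w₂ x)
        (λ x → subst (WhPw a _ _) (sym (Θ≗Γ+Δ x)) (WhPw-++ (p₁ x) (p₂ x)))
        (sumBelow-+ N w₁ w₂)

record WhEnvSplit (a : Pol) (N k : ℕ) (Θ′ Γ Δ : Env) : Set where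
  constructor whEnvSplit
  field
    {Γ₁ Δ₁}   : Env
    {j₁ j₂}   : ℕ
    Γ₁≤Γ      : WhEnv a N j₁ Γ₁ Γ
    Δ₁≤Δ      : WhEnv a N j₂ Δ₁ Δ
    k-split   : k ≡ j₁ + j₂
    Θ′-split  : Θ′ ≗ᴱ (Γ₁ +ᴱ Δ₁)

WhEnv-split : WhEnv a N k Θ′ Θ → Θ ≗ᴱ (Γ +ᴱ Δ) → WhEnvSplit a N k Θ′ Γ Δ
WhEnv-split {a = a} {N = N} {Θ′ = Θ′} {Γ = Γ} (whEnv w p refl) Θ≗Γ+Δ =
  whEnvSplit (whEnv (WhPwSplit.j₁ ∘ split) (WhPwSplit.Ms₁≤M ∘ split) refl)
             (whEnv (WhPwSplit.j₂ ∘ split) (WhPwSplit.Ms₂≤Ns ∘ split) refl)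
             (trans (sumBelow-cong N (WhPwSplit.k-split ∘ split))
                    (sumBelow-+ N (WhPwSplit.j₁ ∘ split) (WhPwSplit.j₂ ∘ split)))
             (WhPwSplit.Ms-split ∘ split)
  where
    split : ∀ x → WhPwSplit a (w x) (Θ′ x) (Γ x) _
    split x = WhPw-split (Γ x) (subst (WhPw a (w x) (Θ′ x)) (Θ≗Γ+Δ x) (p x))

WhEnv-single : x < N → WhL a k L′ L → WhEnv a N k (single x L′) (single x L)
WhEnv-single {x = x} {N = N} {a = a} {k = k} {L′ = L′} {L = L} x<N L′≤L =
  whEnv (update (λ _ → 0) x k) pointwise
        (trans (sumBelow-single N x x<N (λ _ → update-there _ x k)) (update-here _ x k))
  where
    pointwise : ∀ y → WhPw a (update (λ _ → 0) x k y) (single x L′ y) (single x L y)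
    pointwise y with y ≟ x
    ... | yes refl rewrite single-here x L′ | single-here x L =
      WhPw-cast (+-identityʳ k) (L′≤L ∷ [])
    ... | no y≢x rewrite single-there x L′ y≢x | single-there x L y≢x = []

WhEnv-singleʳ : x < N → WhEnv a N k Γ′ (single x L) →
                ∃ λ L′ → Γ′ ≗ᴱ single x L′ × WhL a k L′ L
WhEnv-singleʳ {x = x} {N = N} {a = a} {Γ′ = Γ′} {L = L} x<N (whEnv w p refl)
  with L′ , Γ′x≡[L′] , L′≤L ← WhPw-[-]ʳ (subst (WhPw a (w x) (Γ′ x)) (single-here x L) (p x)) =
  L′ , Γ′≗ , subst (λ k → WhL a k L′ L) (sym (sumBelow-single N x x<N (proj₂ ∘₂ off-x))) L′≤L
  where
    off-x : ∀ y → y ≢ x → Γ′ y ≡ [] × w y ≡ 0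
    off-x y y≢x = WhPw-[]ʳ (subst (WhPw a (w y) (Γ′ y)) (single-there x L y≢x) (p y))
    Γ′≗ : Γ′ ≗ᴱ single x L′
    Γ′≗ y with y ≟ x
    ... | yes refl = trans Γ′x≡[L′] (sym (single-here x L′))
    ... | no  y≢x  = trans (proj₁ (off-x y y≢x)) (sym (single-there x L′ y≢x))

WhEnv-update : x < N → Γ x ≡ [] → WhEnv a N k Γ′ Γ → WhPw a j M′ M →
               WhEnv a N (k + j) (update Γ′ x M′) (update Γ x M)
WhEnv-update {x = x} {N = N} {a = a} {j = j} {M′ = M′} {M = M} x<N Γx≡[] Γ′≤Γ@(whEnv w p refl) M′≤M =
  whEnv (update w x j) pointwise total
  where
    pointwise : ∀ y → WhPw a (update w x j y) (update _ x M′ y) (update _ x M y)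
    pointwise y with y ≟ x
    ... | yes refl = M′≤M
    ... | no  _    = p y
    total : sumBelow N (update w x j) ≡ sumBelow N w + j
    total = begin
      sumBelow N (update w x j)        ≡⟨ +-identityʳ _ ⟨
      sumBelow N (update w x j) + 0    ≡⟨ cong (sumBelow N (update w x j) +_) (proj₂ (WhEnv-[]ʳ Γ′≤Γ Γx≡[])) ⟨
      sumBelow N (update w x j) + w x  ≡⟨ sumBelow-update N w x j x<N ⟩
      sumBelow N w + j                 ∎
      where open ≡-Reasoning

WhEnv-update⁻ : x < N → Γ x ≡ [] → WhEnv a N k Γ′ (update Γ x M) →
                ∃₂ λ k₁ k₂ → WhEnv a N k₁ (update Γ′ x []) Γ × WhPw a k₂ (Γ′ x) M × k ≡ k₁ + k₂
WhEnv-update⁻ {x = x} {N = N} {Γ = Γ} {a = a} {Γ′ = Γ′} {M = M} x<N Γx≡[] (whEnv w p refl) =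
  _ , w x , whEnv (update w x 0) pointwise refl ,
  subst (WhPw a (w x) (Γ′ x)) (update-here Γ x M) (p x) ,
  sym (trans (sumBelow-update N w x 0 x<N) (+-identityʳ _))
  where
    pointwise : ∀ y → WhPw a (update w x 0 y) (update Γ′ x [] y) (Γ y)
    pointwise y with y ≟ x
    ... | yes refl = subst (WhPw a 0 []) (sym Γx≡[]) []
    ... | no  y≢x  = subst (WhPw a (w y) (Γ′ y)) (update-there Γ x M y≢x) (p y)

WhEnv⇒WEnv : WhEnv a N k Γ′ Γ → (∀ x → N ≤ x → Γ x ≡ []) → WEnv a k Γ′ Γ
WhEnv⇒WEnv {N = N} Γ′≤Γ@(whEnv w p total) Γ-support =
  w , (λ x → WhM⇒WM (WhPw⇒WhM (p x))) ,
  N , (λ x N≤x → proj₂ (WhEnv-[]ʳ Γ′≤Γ (Γ-support x N≤x))) , trans (sum-upTo N w) total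

varBound : Term → ℕ
varBound (var x)     = suc x
varBound (lam _ x t) = suc x + varBound t
varBound (app _ t u) = varBound t + varBound u

⊢-support  : Γ ⊢[ k ] t ∶ L → ∀ y → varBound t ≤ y → Γ y ≡ []
⊢m-support : Γ ⊢m[ k ] t ∶ M → ∀ y → varBound t ≤ y → Γ y ≡ []
⊢-support (ax {x = x} {L = L} Γ≗) y x<y = trans (Γ≗ y) (single-there x L (<⇒≢ x<y ∘ sym))
⊢-support (lm {t = t} _ x ⊢t Γx≡[] Γ≗Θ) y bound≤y with y ≟ x
... | yes refl = Γx≡[]
... | no  y≢x  = trans (Γ≗Θ y y≢x) (⊢-support ⊢t y (≤-trans (m≤n+m (varBound t) (suc x)) bound≤y))
⊢-support (ap {t = t} {u = u} _ _ ⊢t ⊢u _ Θ≗) y bound≤y =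
  trans (Θ≗ y) (cong₂ _++_ (⊢-support ⊢t y (≤-trans (m≤m+n (varBound t) (varBound u)) bound≤y))
                           (⊢m-support ⊢u y (≤-trans (m≤n+m (varBound u) (varBound t)) bound≤y)))
⊢m-support (many-nil Γ≗∅) y _ = Γ≗∅ y
⊢m-support (many-cons ⊢t ⊢ts Θ≗) y bound≤y =
  trans (Θ≗ y) (cong₂ _++_ (⊢-support ⊢t y bound≤y) (⊢m-support ⊢ts y bound≤y))

+-mono-≤-interchange : ∀ {a₁ b₁ x₁ y₁ a₂ b₂ x₂ y₂} →
                       a₁ + b₁ ≤ x₁ + y₁ → a₂ + b₂ ≤ x₂ + y₂ →
                       a₁ + a₂ + (b₁ + b₂) ≤ x₁ + x₂ + (y₁ + y₂)
+-mono-≤-interchange {a₁} {b₁} {x₁} {y₁} {a₂} {b₂} {x₂} {y₂} p q =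
  subst₂ _≤_ (interchange a₁ b₁ a₂ b₂) (interchange x₁ y₁ x₂ y₂) (+-mono-≤ p q)

+-mono-≤-interchange₃ : ∀ {a₁ b₁ c₁ x₁ y₁ z₁ a₂ b₂ c₂ x₂ y₂ z₂} →
                        a₁ + b₁ + c₁ ≤ x₁ + y₁ + z₁ → a₂ + b₂ + c₂ ≤ x₂ + y₂ + z₂ →
                        a₁ + a₂ + (b₁ + b₂) + (c₁ + c₂) ≤ x₁ + x₂ + (y₁ + y₂) + (z₁ + z₂)
+-mono-≤-interchange₃ {a₁} {b₁} {c₁} {x₁} {y₁} {z₁} {a₂} {b₂} {c₂} {x₂} {y₂} {z₂} p q =
  subst₂ _≤_ (cong (_+ (c₁ + c₂)) (interchange a₁ b₁ a₂ b₂))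
             (cong (_+ (z₁ + z₂)) (interchange x₁ y₁ x₂ y₂))
             (+-mono-≤-interchange {a₁ + b₁} {c₁} {x₁ + y₁} {z₁} {a₂ + b₂} {c₂} {x₂ + y₂} {z₂} p q)

≤-rebalance : ∀ {x y l r} s → x + r + s ≡ l + y → l ≤ r → x ≤ y
≤-rebalance {x} {y} {l} {r} s eq l≤r = +-cancelʳ-≤ r x y (begin
  x + r      ≤⟨ m≤m+n (x + r) s ⟩
  x + r + s  ≡⟨ eq ⟩
  l + y      ≤⟨ +-monoˡ-≤ y l≤r ⟩
  r + y      ≡⟨ +-comm r y ⟩
  y + r      ∎)
  where open ≤-Reasoning

record Retyping (N : ℕ) (t : Term) (Γ₁ : Env) (T₁ : Lin) (K W : ℕ) : Set where
  constructor retyping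
  field
    {context}    : Env
    {type}       : Lin
    size g h     : ℕ
    derivation   : context ⊢[ size ] t ∶ type
    context≤     : WhEnv neg N g context Γ₁
    type≤        : WhL pos h type T₁
    size-bound   : size + g + h ≤ K
    weight-bound : g + h ≤ W

record Retypingᵐ (N : ℕ) (t : Term) (Γ₁ : Env) (M₁ : Multi) (K W : ℕ) : Set where
  constructor retypingᵐ
  field
    {context}    : Env
    {type}       : Multi
    size g h     : ℕ
    derivation   : context ⊢m[ size ] t ∶ type
    context≤     : WhEnv neg N g context Γ₁
    type≤        : WhM pos h type M₁
    size-bound   : size + g + h ≤ K
    weight-bound : g + h ≤ W

Retypable : ℕ → Term → Set
Retypable N t = ∀ {Γ k T} → Γ ⊢[ k ] t ∶ T →
                ∀ {Γ₁ T₁ e f} → WhEnv pos N e Γ₁ Γ → WhL neg f T₁ T →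
                Retyping N t Γ₁ T₁ (k + e + f) (e + f)

Retypableᵐ : ℕ → Term → Set
Retypableᵐ N t = ∀ {Γ k M} → Γ ⊢m[ k ] t ∶ M →
                 ∀ {Γ₁ M₁ e f} → WhEnv pos N e Γ₁ Γ → WhM neg f M₁ M →
                 Retypingᵐ N t Γ₁ M₁ (k + e + f) (e + f)

retypableᵐ : Retypable N t → Retypableᵐ N t
retypableᵐ _ (many-nil Γ≗∅) Γ₁≤Γ w-nil =
  retypingᵐ 0 0 0 (many-nil (λ _ → refl)) (WhEnv-empty (λ x → proj₁ (WhEnv-[]ʳ Γ₁≤Γ (Γ≗∅ x))))
    w-nil z≤n z≤n
retypableᵐ _ (many-nil _) _ (w-cons () _ _)
retypableᵐ t-retypable (many-cons {Γ₁ = Γ} {Γ₂ = Δ} {k₁ = k₁} {k₂ = k₂} ⊢t ⊢ts Θ≗) Θ₁≤Θ M₁≤L∷M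
  with whEnvSplit {j₁ = e₁} {j₂ = e₂} Γ₁≤Γ Δ₁≤Δ refl Θ₁≗ ← WhEnv-split {Γ = Γ} {Δ = Δ} Θ₁≤Θ Θ≗
  with _ , _ , L₁∈M₁ , f₁ , f₂ , L₁≤L , M₁′≤M , refl ← WhM-removeʳ M₁≤L∷M here
  with retyping k₁′ g₁ h₁ ⊢t′ Γ′≤Γ₁ L′≤L₁ size₁ weight₁ ← t-retypable ⊢t Γ₁≤Γ L₁≤L
  with retypingᵐ k₂′ g₂ h₂ ⊢ts′ Δ′≤Δ₁ M′≤M₁′ size₂ weight₂ ← retypableᵐ t-retypable ⊢ts Δ₁≤Δ M₁′≤M =
  retypingᵐ (k₁′ + k₂′) (g₁ + g₂) (h₁ + h₂) (many-cons ⊢t′ ⊢ts′ (λ _ → refl))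
    (WhEnv-+ Γ′≤Γ₁ Δ′≤Δ₁ Θ₁≗) (w-cons L₁∈M₁ L′≤L₁ M′≤M₁′)
    (+-mono-≤-interchange₃ {k₁′} {g₁} {h₁} {k₁} {e₁} {f₁} {k₂′} {g₂} {h₂} {k₂} {e₂} {f₂} size₁ size₂)
    (+-mono-≤-interchange {g₁} {h₁} {e₁} {f₁} {g₂} {h₂} {e₂} {f₂} weight₁ weight₂)

var-retypable : x < N → Retypable N (var x)
var-retypable x<N (ax Γ≗) {e = e} {f = f} Γ₁≤Γ T₁≤T
  with L′ , Γ₁≗ , L′≤T ← WhEnv-singleʳ x<N (WhEnv-≗ʳ Γ≗ Γ₁≤Γ)
  with T′ , T′≤L′ , T′≤T₁ ← WhL-square L′≤T T₁≤T =
  retyping 0 f e (ax (λ _ → refl)) (WhEnv-≗ʳ (sym ∘ Γ₁≗) (WhEnv-single x<N T′≤L′)) T′≤T₁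
    (≤-reflexive (+-comm f e)) (≤-reflexive (+-comm f e))

lam-retypable : x < N → Retypable N t → Retypable N (lam c x t)
lam-retypable {x = x} x<N t-retypable
  (lm {k = k} c _ ⊢t Γx≡[] Γ≗Θ) {e = e} Γ₁≤Γ (w-arrow {k₁ = f₁} {k₂ = f₂} A₁≤Θx B₁≤B)
  with A₁′ , A₁′≤Θx , A₁′≈A₁ ← WhM⇒WhPw {b = neg} A₁≤Θx
  with retyping k′ g h ⊢t′ Θ′≤ B′≤B₁ size-bound weight-bound
         ← t-retypable ⊢t (WhEnv-≗ʳ (update-agree Γ≗Θ) (WhEnv-update x<N Γx≡[] Γ₁≤Γ A₁′≤Θx)) B₁≤B
  with g₁ , g₂ , Θ′∖x≤Γ₁ , Θ′x≤A₁′ , refl ← WhEnv-update⁻ x<N (proj₁ (WhEnv-[]ʳ Γ₁≤Γ Γx≡[])) Θ′≤ =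
  retyping k′ g₁ (g₂ + h) (lm c x ⊢t′ (update-here _ x []) (λ _ → update-there _ x []))
    Θ′∖x≤Γ₁ (w-arrow (WhM-cast (+-identityʳ g₂) (WhM-trans (WhPw⇒WhM Θ′x≤A₁′) A₁′≈A₁)) B′≤B₁)
    (subst₂ _≤_ (reassoc k′ g₁ g₂ h) (reassoc k e f₁ f₂) size-bound)
    (subst₂ _≤_ (+-assoc g₁ g₂ h) (+-assoc e f₁ f₂) weight-bound)
  where
    reassoc : ∀ a b c d → a + (b + c) + d ≡ a + b + (c + d)
    reassoc = solve-∀

δ-white≤δ-black+1 : ∀ d → δ white d ≤ δ black d + 1
δ-white≤δ-black+1 white = z≤n
δ-white≤δ-black+1 black = s≤s z≤n

record WhArrowʳ (d : Col) (h : ℕ) (S : Lin) (V : Multi) (c : Col) (B : Lin) : Set where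
  constructor whArrowʳ
  field
    {D′}        : Multi
    {c′}        : Col
    {B′}        : Lin
    a′ hB′ r    : ℕ
    S≡          : S ≡ arrow D′ c′ B′
    D′≤V        : WhM neg a′ D′ V
    B′≤B        : WhL pos hB′ B′ B
    h-split     : h ≡ a′ + hB′ + r
    δ-bound     : δ c′ d ≤ δ c d + r

WhL-arrowʳ : ∀ d {h S V c B} → WhL pos h S (arrow V c B) → WhArrowʳ d h S V c B
WhL-arrowʳ d (w-black m l) = whArrowʳ _ _ 1 refl m l refl (δ-white≤δ-black+1 d)
WhL-arrowʳ d (w-arrow m l) =
  whArrowʳ _ _ 0 refl m l (sym (+-identityʳ _)) (≤-reflexive (sym (+-identityʳ _)))

Retyping-≗ʳ : Γ ≗ᴱ Δ → Retyping N t Γ T₁ K W → Retyping N t Δ T₁ K W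
Retyping-≗ʳ Γ≗Δ (retyping k g h ⊢t Γ′≤Γ T′≤T₁ size-bound weight-bound) =
  retyping k g h ⊢t (WhEnv-≗ʳ Γ≗Δ Γ′≤Γ) T′≤T₁ size-bound weight-bound

module Application (N : ℕ) (s v : Term) (d : Col)
                   (s-retypable : Retypable N s) (v-retypable : Retypableᵐ N v)
                   (Γ₁ Δ₁ : Env) (T₁ : Lin) (K W : ℕ) where

  -- Typings of s and v below (Γ₁, Δ₁, T₁) that do not yet fit together: the domain
  -- D of s and the type V of v differ by a whitening of weight m.
  record State (Mismatch : ℕ → Multi → Multi → Set) (D : Multi) : Set where
    constructor state
    field
      {Γs Δv}          : Env
      {V}              : Multi
      {cs}             : Col
      {B}              : Lin
      ks kv gs gv hB m : ℕ
      ⊢s               : Γs ⊢[ ks ] s ∶ arrow D cs B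
      ⊢v               : Δv ⊢m[ kv ] v ∶ V
      mismatch         : Mismatch m D V
      Γs≤Γ₁            : WhEnv neg N gs Γs Γ₁
      Δv≤Δ₁            : WhEnv neg N gv Δv Δ₁
      B≤T₁             : WhL pos hB B T₁
      size-bound       : ks + kv + δ cs d + m + gs + gv + hB ≤ K
      weight-bound     : gs + gv + hB + m ≤ W

  State⁻ State⁺ : Multi → Set
  State⁻ = State (λ a D V → WhM neg a D V)
  State⁺ = State (λ a D V → WhM pos a V D)

  retype-argument : State⁻ M → State⁺ M
  retype-argument (state {cs = cs} ks kv gs gv hB a ⊢s ⊢v D≤V Γs≤Γ₁ Δv≤Δ₁ B≤T₁ size-bound weight-bound)
    with retypingᵐ kv′ gv′ a′ ⊢v′ Δv′≤Δv V′≤D size-bound′ weight-bound′ ← v-retypable ⊢v (WhEnv-refl _) D≤V =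
    state ks kv′ gs (gv′ + gv) hB a′ ⊢s ⊢v′ V′≤D Γs≤Γ₁ (WhEnv-trans Δv′≤Δv Δv≤Δ₁) B≤T₁
      (≤-rebalance 0 (shuffle ks kv′ (δ cs d) a′ gs gv′ gv hB kv a K) (+-mono-≤ size-bound′ size-bound))
      (≤-rebalance 0 (shuffle′ gs gv′ gv hB a′ a W) (+-mono-≤ weight-bound′ weight-bound))
    where
      shuffle : ∀ ks kv′ δ a′ gs gv′ gv hB kv a K →
                ks + kv′ + δ + a′ + gs + (gv′ + gv) + hB + (kv + 0 + a + K) + 0 ≡
                kv′ + gv′ + a′ + (ks + kv + δ + a + gs + gv + hB) + K
      shuffle = solve-∀
      shuffle′ : ∀ gs gv′ gv hB a′ a W →
                 gs + (gv′ + gv) + hB + a′ + (0 + a + W) + 0 ≡ gv′ + a′ + (gs + gv + hB + a) + W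
      shuffle′ = solve-∀

  retype-function : (st : State⁺ M) → ∃ λ D′ → State⁻ D′ × blacksM D′ ≤ blacksM (State.V st)
  retype-function (state {cs = cs} {B = B} ks kv gs gv hB a ⊢s ⊢v V≤D Γs≤Γ₁ Δv≤Δ₁ B≤T₁ size-bound weight-bound)
    with retyping ks′ gs′ _ ⊢s′ Γs′≤Γs S≤ size-bound′ weight-bound′
           ← s-retypable ⊢s (WhEnv-refl _) (w-arrow {a = neg} V≤D (WhL-refl B))
    with whArrowʳ {c′ = cs′} a′ hB′ r refl D′≤V B′≤B refl δ-bound ← WhL-arrowʳ d S≤ =
    _ ,
    state ks′ kv (gs′ + gs) gv (hB′ + hB) a′ ⊢s′ ⊢v D′≤V (WhEnv-trans Γs′≤Γs Γs≤Γ₁) Δv≤Δ₁ (WhL-trans B′≤B B≤T₁)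
      (≤-rebalance 0 (shuffle ks′ kv (δ cs′ d) a′ gs′ gs gv hB′ hB r ks a (δ cs d) K)
                     (+-mono-≤ (+-mono-≤ size-bound′ δ-bound) size-bound))
      (≤-rebalance r (shuffle′ gs′ gs gv hB′ hB a′ r a W) (+-mono-≤ weight-bound′ weight-bound)) ,
    blacks-WhM-≤ D′≤V
    where
      shuffle : ∀ ks′ kv δ′ a′ gs′ gs gv hB′ hB r ks a δ K →
                ks′ + kv + δ′ + a′ + (gs′ + gs) + gv + (hB′ + hB) + (ks + 0 + (a + 0) + (δ + r) + K) + 0 ≡
                ks′ + gs′ + (a′ + hB′ + r) + δ′ + (ks + kv + δ + a + gs + gv + hB) + K
      shuffle = solve-∀
      shuffle′ : ∀ gs′ gs gv hB′ hB a′ r a W →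
                 gs′ + gs + gv + (hB′ + hB) + a′ + (0 + (a + 0) + W) + r ≡
                 gs′ + (a′ + hB′ + r) + (gs + gv + hB + a) + W
      shuffle′ = solve-∀

  finish : (st : State⁺ M) → State.m st ≡ 0 → Retyping N (app d s v) (Γ₁ +ᴱ Δ₁) T₁ K W
  finish (state {cs = cs} ks kv gs gv hB _ ⊢s ⊢v V≤D Γs≤Γ₁ Δv≤Δ₁ B≤T₁ size-bound weight-bound) refl =
    retyping (ks + kv + δ cs d) (gs + gv) hB (ap cs d ⊢s ⊢v (WhM-zero⇒≈M V≤D refl) (λ _ → refl))
      (WhEnv-+ Γs≤Γ₁ Δv≤Δ₁ (λ _ → refl)) B≤T₁
      (subst (_≤ K) (shuffle ks kv (δ cs d) gs gv hB) size-bound)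
      (subst (_≤ W) (+-identityʳ (gs + gv + hB)) weight-bound)
    where
      shuffle : ∀ ks kv δ gs gv hB → ks + kv + δ + 0 + gs + gv + hB ≡ ks + kv + δ + (gs + gv) + hB
      shuffle = solve-∀

  alternate : ∀ n → State⁻ M → blacksM M < n → Retyping N (app d s v) (Γ₁ +ᴱ Δ₁) T₁ K W
  alternate (suc n) st D<n with retype-argument st
  ... | st⁺@(state _ _ _ _ _ zero _ _ _ _ _ _ _ _) = finish st⁺ refl
  ... | st⁺@(state _ _ _ _ _ (suc _) _ _ V≤D _ _ _ _ _) with _ , st′ , D′≤V ← retype-function st⁺ =
    alternate n st′ (<-≤-trans (≤-<-trans D′≤V (blacks-WhM-< V≤D)) (≤-pred D<n))

  resolve⁻ : State⁻ M → Retyping N (app d s v) (Γ₁ +ᴱ Δ₁) T₁ K W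
  resolve⁻ st = alternate _ st ≤-refl

  resolve⁺ : State⁺ M → Retyping N (app d s v) (Γ₁ +ᴱ Δ₁) T₁ K W
  resolve⁺ st = resolve⁻ (proj₁ (proj₂ (retype-function st)))

app-retypable : Retypable N t → Retypableᵐ N u → Retypable N (app d t u)
app-retypable {N = N} {t = t} {u = u} {d = d} t-retypable u-retypable
  (ap {Γ = Γ} {Δ = Δ} {k₁ = k₁} {k₂ = k₂} {M' = M′} c _ ⊢t ⊢u M′≈M Θ≗) {T₁ = T₁} {f = f} Θ₁≤Θ T₁≤L
  with whEnvSplit {Γ₁ = Γ₁} {Δ₁ = Δ₁} {j₁ = e₁} {j₂ = e₂} Γ₁≤Γ Δ₁≤Δ refl Θ₁≗
         ← WhEnv-split {Γ = Γ} {Δ = Δ} Θ₁≤Θ Θ≗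
  with retypingᵐ kv gv hv ⊢u′ Δv≤Δ₁ V≤M′ size-u weight-u ← u-retypable ⊢u Δ₁≤Δ (WhM-refl M′)
  with retyping ks gs _ ⊢t′ Γs≤Γ₁ S≤ size-t weight-t
         ← t-retypable ⊢t Γ₁≤Γ (w-arrow (WhM-trans V≤M′ (≈M⇒WhM M′≈M)) T₁≤L)
  with whArrowʳ {c′ = cs} m hB r refl D≤V B≤T₁ refl δ-bound ← WhL-arrowʳ d S≤ =
  Retyping-≗ʳ (sym ∘ Θ₁≗) (resolve⁻ (state ks kv gs gv hB m ⊢t′ ⊢u′ D≤V Γs≤Γ₁ Δv≤Δ₁ B≤T₁
    (≤-rebalance 0 (shuffle ks kv (δ cs d) m gs gv hB r k₁ e₁ hv f k₂ e₂ (δ c d))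
                   (+-mono-≤ (+-mono-≤ (+-mono-≤ size-t size-u) δ-bound) ≤-refl))
    (≤-rebalance r (shuffle′ gs gv hB m r e₁ hv f e₂) (+-mono-≤ weight-t weight-u))))
  where
    open Application N t u d t-retypable u-retypable Γ₁ Δ₁ T₁ (k₁ + k₂ + δ c d + (e₁ + e₂) + f) (e₁ + e₂ + f)
    shuffle : ∀ ks kv δ m gs gv hB r k₁ e₁ hv f k₂ e₂ δ′ →
              ks + kv + δ + m + gs + gv + hB + (k₁ + e₁ + (hv + 0 + f) + (k₂ + e₂ + 0) + (δ′ + r) + 0) + 0 ≡
              ks + gs + (m + hB + r) + (kv + gv + hv) + δ + 0 + (k₁ + k₂ + δ′ + (e₁ + e₂) + f)
    shuffle = solve-∀
    shuffle′ : ∀ gs gv hB m r e₁ hv f e₂ →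
               gs + gv + hB + m + (e₁ + (hv + 0 + f) + (e₂ + 0)) + r ≡
               gs + (m + hB + r) + (gv + hv) + (e₁ + e₂ + f)
    shuffle′ = solve-∀

retypable : ∀ N t → varBound t ≤ N → Retypable N t
retypable N (var x) x<N = var-retypable x<N
retypable N (lam c x t) bound≤N =
  lam-retypable (≤-trans (m≤m+n (suc x) (varBound t)) bound≤N)
                (retypable N t (≤-trans (m≤n+m (varBound t) (suc x)) bound≤N))
retypable N (app d t u) bound≤N =
  app-retypable (retypable N t (≤-trans (m≤m+n (varBound t) (varBound u)) bound≤N))
                (retypableᵐ (retypable N u (≤-trans (m≤n+m (varBound u) (varBound t)) bound≤N)))

app-Retyping⇒WPair :
  (∀ x → N ≤ x → (Γ +ᴱ Δ) x ≡ []) → Retyping N (app d t u) (Γ +ᴱ Δ) L K W →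
  Σ Env λ Γ′ → Σ Env λ Δ′ → Σ Lin λ L′ → Σ ℕ λ m → Σ ℕ λ d′ →
    d′ ≤ W × (Γ′ +ᴱ Δ′) ⊢[ m ] app d t u ∶ L′ ×
    WPair pos d′ ((Γ′ +ᴱ Δ′) , L′) ((Γ +ᴱ Δ) , L) × m + d′ ≤ K
app-Retyping⇒WPair {K = K} Γ+Δ-support
  (retyping m g h (ap {Γ = Γ′} {Δ = Δ′} c d ⊢t ⊢u M′≈M Θ≗) Θ≤Γ+Δ L′≤L size-bound weight-bound) =
  Γ′ , Δ′ , _ , m , g + h , weight-bound , ap c d ⊢t ⊢u M′≈M (λ _ → refl) ,
  (g , h , refl , WhEnv⇒WEnv (WhEnv-≗ˡ Θ≗ Θ≤Γ+Δ) Γ+Δ-support , WhL⇒WL L′≤L) ,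
  subst (_≤ K) (+-assoc m g h) size-bound

proposition3 : (t u : Term) (c b : Col) (Γ Δ : Env) (M N : Multi) (L : Lin)
               (k l d : ℕ) →
               Γ ⊢[ k ] t ∶ arrow M c L → Δ ⊢m[ l ] u ∶ N →
               (WM neg d M N ⊎ WM pos d N M) →
               Σ Env λ Γ' → Σ Env λ Δ' → Σ Lin λ L' → Σ ℕ λ m → Σ ℕ λ d' →
                 d' ≤ d ×
                 (Γ' +ᴱ Δ') ⊢[ m ] app b t u ∶ L' ×
                 WPair pos d' ((Γ' +ᴱ Δ') , L') ((Γ +ᴱ Δ) , L) ×
                 m + d' ≤ k + l + δ c b + d
proposition3 t u c b Γ Δ M N L k l d ⊢t ⊢u M≲N =
  app-Retyping⇒WPair {Γ = Γ} {Δ = Δ} Γ+Δ-support (resolve M≲N)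
  where
    bound : ℕ
    bound = varBound t + varBound u
    t≤bound : varBound t ≤ bound
    t≤bound = m≤m+n (varBound t) (varBound u)
    u≤bound : varBound u ≤ bound
    u≤bound = m≤n+m (varBound u) (varBound t)
    open Application bound t u b (retypable bound t t≤bound) (retypableᵐ (retypable bound u u≤bound))
                     Γ Δ L (k + l + δ c b + d) d
    start : ∀ {Mismatch} → Mismatch d M N → State Mismatch M
    start mismatch = state k l 0 0 0 d ⊢t ⊢u mismatch (WhEnv-refl Γ) (WhEnv-refl Δ) (WhL-refl L)
      (≤-reflexive (trans (+-identityʳ _) (trans (+-identityʳ _) (+-identityʳ _)))) ≤-refl
    resolve : WM neg d M N ⊎ WM pos d N M → Retyping bound (app b t u) (Γ +ᴱ Δ) L (k + l + δ c b + d) d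
    resolve (inj₁ M≤N) = resolve⁻ (start (WM⇒WhM M≤N))
    resolve (inj₂ N≤M) = resolve⁺ (start (WM⇒WhM N≤M))
    Γ+Δ-support : ∀ x → bound ≤ x → (Γ +ᴱ Δ) x ≡ []
    Γ+Δ-support x bound≤x = cong₂ _++_ (⊢-support ⊢t x (≤-trans t≤bound bound≤x))
                                       (⊢m-support ⊢u x (≤-trans u≤bound bound≤x))
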